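{- If $T$ is a tree having no two adjacent vertices both of degree at least three, then $\overrightarrow{\chi}(T)\leq 2$. If $T$ is a tree having no two adjacent vertices both of degree at least four, then $\overrightarrow{\chi}(T)\leq 3$.
   Context: An orientation $D$ of a graph $G$ replaces each edge by exactly one of its two possible arcs; $d^-_D(v)$ is the indegree of $v$. $D$ is proper if adjacent vertices have distinct indegrees; a $k$-orientation has maximum indegree at most $k$. $\overrightarrow{\chi}(G)$ is the minimum $k$ such that $G$ admits a proper $k$-orientation. -}

module Defs where

open import Data.Nat using (ℕ; zero; suc; _≤_; _≥_)
open import Data.Fin using (Fin)
open import Data.Bool using (Bool; true; false; _xor_)
open import Data.List using (List; []; _∷_; _++_; length; filter; allFin)
open import Data.Empty using (⊥)
open import Data.List.Relation.Unary.Linked using (Linked)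
open import Data.List.Relation.Unary.Unique.Propositional using (Unique)
open import Data.Product using (Σ; _×_; ∃)
open import Relation.Binary.PropositionalEquality using (_≡_; _≢_)
open import Relation.Nullary using (¬_)
open import Data.Bool.Properties using (T?)
open import Data.Bool using (T)

record Graph (n : ℕ) : Set where
  field
    adj       : Fin n → Fin n → Bool
    symmetric : ∀ u v → adj u v ≡ adj v u
    loopless  : ∀ v → adj v v ≡ false
open Graph public

count : ∀ {n} → (Fin n → Bool) → ℕ
count {n} f = length (filter (λ w → T? (f w)) (allFin n))

degree : ∀ {n} → Graph n → Fin n → ℕ
degree G v = count (λ w → adj G v w)

data Walk {n} (G : Graph n) : Fin n → Fin n → Set where
  stop : ∀ {u} → Walk G u u
  step : ∀ {u v w} → adj G u v ≡ true → Walk G v w → Walk G u w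

Connected : ∀ {n} → Graph n → Set
Connected G = ∀ u v → Walk G u v

IsCycle : ∀ {n} → Graph n → List (Fin n) → Set
IsCycle G [] = ⊥
IsCycle G (x ∷ xs) =
  (3 ≤ length (x ∷ xs)) × Unique (x ∷ xs) ×
  Linked (λ a b → adj G a b ≡ true) ((x ∷ xs) ++ (x ∷ []))

Acyclic : ∀ {n} → Graph n → Set
Acyclic G = ∀ cs → ¬ IsCycle G cs

IsTree : ∀ {n} → Graph n → Set
IsTree {n} G = (1 ≤ n) × Connected G × Acyclic G

record Orientation {n} (G : Graph n) : Set where
  field
    arc      : Fin n → Fin n → Bool
    arc⇒edge : ∀ u v → arc u v ≡ true → adj G u v ≡ true
    oneDir   : ∀ u v → adj G u v ≡ true → arc u v xor arc v u ≡ true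
open Orientation public

indegree : ∀ {n} {G : Graph n} → Orientation G → Fin n → ℕ
indegree D v = count (λ u → arc D u v)

Proper : ∀ {n} {G : Graph n} → Orientation G → Set
Proper {G = G} D = ∀ u v → adj G u v ≡ true → indegree D u ≢ indegree D v

IsKOrientation : ∀ {n} {G : Graph n} → ℕ → Orientation G → Set
IsKOrientation k D = ∀ v → indegree D v ≤ k

-- χ⃗(G) ≤ k  (χ⃗ is the least k admitting a proper k-orientation, so this holds
-- iff G admits a proper k-orientation)
OrientedChromatic≤ : ∀ {n} → Graph n → ℕ → Set
OrientedChromatic≤ G k = Σ (Orientation G) (λ D → Proper D × IsKOrientation k D)

NoAdjacentBothDeg≥ : ∀ {n} → Graph n → ℕ → Set
NoAdjacentBothDeg≥ G d =
  ∀ u v → adj G u v ≡ true → ¬ (d ≤ degree G u × d ≤ degree G v)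

-- A tree is bipartite: colour each vertex by the parity of the length of a walk to it from a fixed
-- root. Two adjacent vertices of equal colour would close a walk of odd length, and an odd closed
-- walk contains a cycle: split it at a repeated vertex into two shorter closed walks, one of which
-- is still odd.
--
-- So it suffices to properly K-orient, for K ≤ 3, a bipartite graph in which no two adjacent
-- vertices are big (of degree > K). Big vertices become sources. An edge between small vertices
-- a (side 0ℙ) and w (side 1ℙ) is oriented towards w exactly when w has a big neighbour and
-- deg a < K. Every indegree is then at most K, and adjacent a, w get different indegrees: if w has
-- no big neighbour it is a source and a is not; if deg a = K then every edge at a enters a, so
-- d⁻ a = K > d⁻ w; otherwise d⁻ a < deg a < K ≤ 3, so d⁻ a ≤ 1, while w receives arcs both from a
-- and from a big neighbour.

module Submission where

open import Defs
open import Data.Bool using (Bool; true; false; not; _∧_; _∨_; _xor_; T)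
open import Data.Bool.ListAction using (any)
open import Data.Bool.Properties using (T?; T-≡; T-∧; ∧-zeroʳ; xor-inverseˡ; xor-inverseʳ)
open import Data.Empty using (⊥; ⊥-elim)
open import Data.Fin using (Fin; fromℕ<)
open import Data.Fin.Properties using (_≟_)
open import Data.List using (List; []; _∷_; _++_; [_]; length; filter; allFin)
open import Data.List.Properties using (++-assoc; ++-identityʳ; length-++; filter-some; filter-none)
open import Data.List.Membership.Propositional using (_∈_)
open import Data.List.Membership.Propositional.Properties using (∈-∃++; ∈-allFin)
import Data.List.Membership.DecPropositional as DecMembership
open import Data.List.Relation.Binary.Permutation.Propositional.Properties using (↭-length; ++-comm)
open import Data.List.Relation.Unary.All using (universal)
open import Data.List.Relation.Unary.All.Properties using (¬Any⇒All¬)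
open import Data.List.Relation.Unary.AllPairs using ([]; _∷_)
open import Data.List.Relation.Unary.Any using (here; there; satisfied)
import Data.List.Relation.Unary.Any as Any
open import Data.List.Relation.Unary.Any.Properties using (any⁺; any⁻)
open import Data.List.Relation.Unary.Linked using (Linked; [-]; _∷_)
open import Data.List.Relation.Unary.Unique.Propositional using (Unique)
open import Data.Nat using (ℕ; suc; _+_; _≤_; _<_; _<ᵇ_; _≤ᵇ_; z≤n; s≤s; parity)
open import Data.Nat.Induction using (<-wellFounded)
open import Data.Nat.Properties
  using ( +-comm; n≤1+n; ≤-refl; m≤n⇒m≤1+n; m<m+n; m<n+m; ≤-trans; <-≤-trans; ≤-pred; <⇒≢; >⇒≢
        ; ≮⇒≥; ≰⇒>; <ᵇ⇒<; <⇒<ᵇ; ≤ᵇ⇒≤; ≤⇒≤ᵇ; module ≤-Reasoning)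
open import Data.Parity using (Parity; 0ℙ; 1ℙ; _⁻¹) renaming (_+_ to _+ℙ_)
open import Data.Parity.Properties using (+-homo-+; p+p⁻¹≡1ℙ)
open import Data.Product using (Σ; ∃; _×_; _,_; proj₁; proj₂; uncurry)
open import Data.Sum using (_⊎_; inj₁; inj₂; [_,_]′)
open import Function using (Equivalence; _∘_)
open import Induction.WellFounded using (Acc; acc)
open import Relation.Binary.Definitions using (DecidableEquality)
open import Relation.Binary.PropositionalEquality
  using (_≡_; _≢_; refl; sym; trans; cong; subst; ≢-sym; module ≡-Reasoning)
open import Relation.Nullary using (¬_; yes; no)

countIn : {A : Set} → (A → Bool) → List A → ℕ
countIn f xs = length (filter (λ x → T? (f x)) xs)

module _ {A : Set} {f : A → Bool} where

  countIn-pos : ∀ {y xs} → y ∈ xs → f y ≡ true → 0 < countIn f xs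
  countIn-pos y∈xs fy =
    filter-some (λ x → T? (f x)) (Any.map (λ { refl → Equivalence.from T-≡ fy }) y∈xs)

  countIn-zero : (∀ x → f x ≡ false) → ∀ xs → countIn f xs ≡ 0
  countIn-zero none xs =
    cong length (filter-none (λ x → T? (f x)) (universal (λ x → subst T (none x)) xs))

  countIn-two : ∀ {y z xs} → y ≢ z → y ∈ xs → z ∈ xs → f y ≡ true → f z ≡ true →
                2 ≤ countIn f xs
  countIn-two y≢z (here refl) (here refl) _ _ with () ← y≢z refl
  countIn-two _ (here refl) (there z∈xs) fy fz rewrite fy = s≤s (countIn-pos z∈xs fz)
  countIn-two _ (there y∈xs) (here refl) fy fz rewrite fz = s≤s (countIn-pos y∈xs fy)
  countIn-two {xs = x ∷ xs} y≢z (there y∈xs) (there z∈xs) fy fz with f x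
  ... | true  = m≤n⇒m≤1+n (countIn-two y≢z y∈xs z∈xs fy fz)
  ... | false = countIn-two y≢z y∈xs z∈xs fy fz

module _ {A : Set} {f g : A → Bool} (f⇒g : ∀ x → f x ≡ true → g x ≡ true) where

  countIn-mono : ∀ xs → countIn f xs ≤ countIn g xs
  countIn-mono [] = z≤n
  countIn-mono (x ∷ xs) with f x in fx | g x in gx
  ... | true  | true  = s≤s (countIn-mono xs)
  ... | true  | false with () ← trans (sym (f⇒g x fx)) gx
  ... | false | true  = m≤n⇒m≤1+n (countIn-mono xs)
  ... | false | false = countIn-mono xs

  countIn-strictMono : ∀ {y xs} → y ∈ xs → g y ≡ true → f y ≡ false →
                       countIn f xs < countIn g xs
  countIn-strictMono {xs = _ ∷ xs} (here refl) gy fy rewrite gy | fy = s≤s (countIn-mono xs)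
  countIn-strictMono {xs = x ∷ xs} (there y∈xs) gy fy with f x in fx | g x in gx
  ... | true  | true  = s≤s (countIn-strictMono y∈xs gy fy)
  ... | true  | false with () ← trans (sym (f⇒g x fx)) gx
  ... | false | true  = m≤n⇒m≤1+n (countIn-strictMono y∈xs gy fy)
  ... | false | false = countIn-strictMono y∈xs gy fy

parity-odd-+ : ∀ m n → parity (m + n) ≡ 1ℙ → parity m ≡ 1ℙ ⊎ parity n ≡ 1ℙ
parity-odd-+ m n odd with parity m in pm
... | 0ℙ = inj₂ (trans (sym (trans (+-homo-+ m n) (cong (λ p → p +ℙ parity n) pm))) odd)
... | 1ℙ = inj₁ refl

≢⇒≡⁻¹ : ∀ {p q : Parity} → p ≢ q → q ≡ p ⁻¹
≢⇒≡⁻¹ {0ℙ} {0ℙ} p≢q = ⊥-elim (p≢q refl)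
≢⇒≡⁻¹ {0ℙ} {1ℙ} _ = refl
≢⇒≡⁻¹ {1ℙ} {0ℙ} _ = refl
≢⇒≡⁻¹ {1ℙ} {1ℙ} p≢q = ⊥-elim (p≢q refl)

module _ {A : Set} where

  data HasRepeat : List A → Set where
    repeat : ∀ ps y qs rs → HasRepeat (ps ++ y ∷ qs ++ y ∷ rs)

  unique-or-repeat : DecidableEquality A → (xs : List A) → Unique xs ⊎ HasRepeat xs
  unique-or-repeat _≟_ [] = inj₁ []
  unique-or-repeat _≟_ (x ∷ xs) with DecMembership._∈?_ _≟_ x xs
  ... | yes x∈xs with qs , rs , refl ← ∈-∃++ x∈xs = inj₂ (repeat [] x qs rs)
  ... | no x∉xs with unique-or-repeat _≟_ xs
  ...   | inj₁ unique = inj₁ (¬Any⇒All¬ xs x∉xs ∷ unique)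
  ...   | inj₂ (repeat ps y qs rs) = inj₂ (repeat (x ∷ ps) y qs rs)

  repeat-length : ∀ (ps : List A) y qs rs →
                  length (ps ++ y ∷ qs ++ y ∷ rs) ≡ length (y ∷ qs) + length (y ∷ rs ++ ps)
  repeat-length ps y qs rs = begin
    length (ps ++ y ∷ qs ++ y ∷ rs)   ≡⟨ ↭-length (++-comm ps (y ∷ qs ++ y ∷ rs)) ⟩
    length ((y ∷ qs ++ y ∷ rs) ++ ps) ≡⟨ cong (λ zs → length (y ∷ zs)) (++-assoc qs (y ∷ rs) ps) ⟩
    length ((y ∷ qs) ++ y ∷ rs ++ ps) ≡⟨ length-++ (y ∷ qs) ⟩
    length (y ∷ qs) + length (y ∷ rs ++ ps) ∎
    where open ≡-Reasoning

module _ {A : Set} {R : A → A → Set} where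

  Linked-split : ∀ xs {y} ys → Linked R (xs ++ y ∷ ys) → Linked R (xs ++ [ y ]) × Linked R (y ∷ ys)
  Linked-split [] ys l = [-] , l
  Linked-split (x ∷ []) ys (r ∷ l) = r ∷ [-] , l
  Linked-split (x ∷ x′ ∷ xs) ys (r ∷ l)
    with l₁ , l₂ ← Linked-split (x′ ∷ xs) ys l = r ∷ l₁ , l₂

  Linked-join : ∀ xs {y} ys → Linked R (xs ++ [ y ]) → Linked R (y ∷ ys) → Linked R (xs ++ y ∷ ys)
  Linked-join [] ys _ l = l
  Linked-join (x ∷ []) ys (r ∷ _) l = r ∷ l
  Linked-join (x ∷ x′ ∷ xs) ys (r ∷ l₁) l₂ = r ∷ Linked-join (x′ ∷ xs) ys l₁ l₂

  Closed : List A → Set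
  Closed [] = ⊥
  Closed (x ∷ xs) = Linked R (x ∷ xs ++ [ x ])

  Closed-rotate : ∀ xs ys → Closed (xs ++ ys) → Closed (ys ++ xs)
  Closed-rotate [] ys c rewrite ++-identityʳ ys = c
  Closed-rotate (x ∷ xs) [] c rewrite ++-identityʳ xs = c
  Closed-rotate (x ∷ xs) (y ∷ ys) c
    rewrite ++-assoc xs (y ∷ ys) [ x ] | ++-assoc ys (x ∷ xs) [ y ]
    with l₁ , l₂ ← Linked-split (x ∷ xs) (ys ++ [ x ]) c
    = Linked-join (y ∷ ys) (xs ++ [ y ]) l₂ l₁

  Closed-split : ∀ y xs ys → Closed (y ∷ xs ++ y ∷ ys) → Closed (y ∷ xs) × Closed (y ∷ ys)
  Closed-split y xs ys c rewrite ++-assoc xs (y ∷ ys) [ y ] = Linked-split (y ∷ xs) (ys ++ [ y ]) c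

  Closed-split-repeat : ∀ ps y qs rs → Closed (ps ++ y ∷ qs ++ y ∷ rs) →
                        Closed (y ∷ qs) × Closed (y ∷ rs ++ ps)
  Closed-split-repeat ps y qs rs c = Closed-split y qs (rs ++ ps)
    (subst Closed (cong (y ∷_) (++-assoc qs (y ∷ rs) ps)) (Closed-rotate ps (y ∷ qs ++ y ∷ rs) c))

  OddClosed : List A → Set
  OddClosed xs = Closed xs × parity (length xs) ≡ 1ℙ

  SimpleClosed : List A → Set
  SimpleClosed cs = 3 ≤ length cs × Unique cs × Closed cs

  OddClosed-shorten : ∀ ps y qs rs → OddClosed (ps ++ y ∷ qs ++ y ∷ rs) →
    Σ (List A) λ zs → length zs < length (ps ++ y ∷ qs ++ y ∷ rs) × OddClosed zs
  OddClosed-shorten ps y qs rs (c , odd) =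
    [ (λ odd₁ → y ∷ qs , shorter (m<m+n m (s≤s z≤n)) , c₁ , odd₁)
    , (λ odd₂ → y ∷ rs ++ ps , shorter (m<n+m n (s≤s z≤n)) , c₂ , odd₂)
    ]′ (parity-odd-+ m n (subst (λ k → parity k ≡ 1ℙ) total odd))
    where
    m = length (y ∷ qs)
    n = length (y ∷ rs ++ ps)
    total : length (ps ++ y ∷ qs ++ y ∷ rs) ≡ m + n
    total = repeat-length ps y qs rs
    shorter : ∀ {k} → k < m + n → k < length (ps ++ y ∷ qs ++ y ∷ rs)
    shorter = subst (_ <_) (sym total)
    c₁ = proj₁ (Closed-split-repeat ps y qs rs c)
    c₂ = proj₂ (Closed-split-repeat ps y qs rs c)

  module _ (irreflexive : ∀ {x} → ¬ R x x) where

    OddClosed-length : ∀ xs → OddClosed xs → 3 ≤ length xs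
    OddClosed-length (x ∷ []) (r ∷ _ , _) with () ← irreflexive r
    OddClosed-length (x ∷ y ∷ []) (_ , ())
    OddClosed-length (x ∷ y ∷ z ∷ _) _ = s≤s (s≤s (s≤s z≤n))

    OddClosed⇒SimpleClosed : DecidableEquality A → ∀ xs → OddClosed xs → Σ (List A) SimpleClosed
    OddClosed⇒SimpleClosed _≟_ xs = go xs (<-wellFounded (length xs))
      where
      go : ∀ xs → Acc _<_ (length xs) → OddClosed xs → Σ (List A) SimpleClosed
      go xs (acc shorter) oc with unique-or-repeat _≟_ xs
      ... | inj₁ unique = xs , OddClosed-length xs oc , unique , proj₁ oc
      ... | inj₂ (repeat ps y qs rs) with zs , smaller , oc′ ← OddClosed-shorten ps y qs rs oc
        = go zs (shorter smaller) oc′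

module _ {n} (G : Graph n) where

  Edge : Fin n → Fin n → Set
  Edge u v = adj G u v ≡ true

  Edge-sym : ∀ {u v} → Edge u v → Edge v u
  Edge-sym {u} {v} e = trans (symmetric G v u) e

  Edge-irreflexive : ∀ {v} → ¬ Edge v v
  Edge-irreflexive {v} e with () ← trans (sym e) (loopless G v)

  vertices : ∀ {u v} → Walk G u v → List (Fin n)
  vertices stop = []
  vertices (step {u} _ p) = u ∷ vertices p

  Linked-vertices : ∀ {u v} (p : Walk G u v) → Linked Edge (vertices p ++ [ v ])
  Linked-vertices stop = [-]
  Linked-vertices (step e stop) = e ∷ [-]
  Linked-vertices (step e p@(step _ _)) = e ∷ Linked-vertices p

  _++ᵂ_ : ∀ {u v w} → Walk G u v → Walk G v w → Walk G u w
  stop ++ᵂ q = q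
  step e p ++ᵂ q = step e (p ++ᵂ q)

  reverseᵂ : ∀ {u v} → Walk G u v → Walk G v u
  reverseᵂ stop = stop
  reverseᵂ (step e p) = reverseᵂ p ++ᵂ step (Edge-sym e) stop

  vertices-++ : ∀ {u v w} (p : Walk G u v) (q : Walk G v w) →
                vertices (p ++ᵂ q) ≡ vertices p ++ vertices q
  vertices-++ stop q = refl
  vertices-++ (step e p) q = cong (_ ∷_) (vertices-++ p q)

  length-reverseᵂ : ∀ {u v} (p : Walk G u v) → length (vertices (reverseᵂ p)) ≡ length (vertices p)
  length-reverseᵂ (step e p) = begin
    length (vertices (reverseᵂ p ++ᵂ step (Edge-sym e) stop))
      ≡⟨ cong length (vertices-++ (reverseᵂ p) _) ⟩
    length (vertices (reverseᵂ p) ++ [ _ ])  ≡⟨ length-++ (vertices (reverseᵂ p)) ⟩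
    length (vertices (reverseᵂ p)) + 1       ≡⟨ cong (_+ 1) (length-reverseᵂ p) ⟩
    length (vertices p) + 1                  ≡⟨ +-comm (length (vertices p)) 1 ⟩
    suc (length (vertices p))                ∎
    where open ≡-Reasoning
  length-reverseᵂ stop = refl

  odd-closed-walk⇒cycle : ∀ {v} (p : Walk G v v) → parity (length (vertices p)) ≡ 1ℙ →
                          ∃ (IsCycle G)
  odd-closed-walk⇒cycle stop ()
  odd-closed-walk⇒cycle p@(step _ _) odd
    with x ∷ xs , simple ← OddClosed⇒SimpleClosed Edge-irreflexive _≟_ (vertices p) (Linked-vertices p , odd)
    = x ∷ xs , simple

  module _ (connected : Connected G) (root : Fin n) where

    side : Fin n → Parity
    side v = parity (length (vertices (connected root v)))

    same-side⇒cycle : ∀ {u v} → Edge u v → side u ≡ side v → ∃ (IsCycle G)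
    same-side⇒cycle {u} {v} e same = odd-closed-walk⇒cycle (p ++ᵂ step e (reverseᵂ q)) odd
      where
      p = connected root u
      q = connected root v
      odd : parity (length (vertices (p ++ᵂ step e (reverseᵂ q)))) ≡ 1ℙ
      odd = begin
        parity (length (vertices (p ++ᵂ step e (reverseᵂ q))))
          ≡⟨ cong (λ xs → parity (length xs)) (vertices-++ p _) ⟩
        parity (length (vertices p ++ u ∷ vertices (reverseᵂ q)))
          ≡⟨ cong parity (length-++ (vertices p)) ⟩
        parity (length (vertices p) + suc (length (vertices (reverseᵂ q))))
          ≡⟨ cong (λ k → parity (length (vertices p) + suc k)) (length-reverseᵂ q) ⟩
        parity (length (vertices p) + suc (length (vertices q)))
          ≡⟨ +-homo-+ (length (vertices p)) _ ⟩
        side u +ℙ parity (1 + length (vertices q))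
          ≡⟨ cong (side u +ℙ_) (+-homo-+ 1 (length (vertices q))) ⟩
        side u +ℙ side v ⁻¹  ≡⟨ cong (λ s → side u +ℙ s ⁻¹) (sym same) ⟩
        side u +ℙ side u ⁻¹  ≡⟨ p+p⁻¹≡1ℙ (side u) ⟩
        1ℙ                   ∎
        where open ≡-Reasoning

  Bipartite : Set
  Bipartite = Σ (Fin n → Parity) λ side → ∀ {u v} → Edge u v → side u ≢ side v

  tree⇒bipartite : IsTree G → Bipartite
  tree⇒bipartite (1≤n , connected , acyclic) =
    side connected root , λ e same → uncurry acyclic (same-side⇒cycle connected root e same)
    where root = fromℕ< 1≤n

module SparseBipartite {n} (G : Graph n) (K : ℕ) (K≤3 : K ≤ 3)
  (side : Fin n → Parity) (bipartite : ∀ {u v} → Edge G u v → side u ≢ side v)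
  (sparse : NoAdjacentBothDeg≥ G (suc K)) where

  big : Fin n → Bool
  big v = K <ᵇ degree G v

  saturated : Fin n → Bool
  saturated v = K ≤ᵇ degree G v

  nearBig : Fin n → Bool
  nearBig w = any (λ y → adj G w y ∧ big y) (allFin n)

  big⇒> : ∀ {v} → big v ≡ true → K < degree G v
  big⇒> {v} b = <ᵇ⇒< K (degree G v) (Equivalence.from T-≡ b)

  small⇒≤ : ∀ {v} → big v ≡ false → degree G v ≤ K
  small⇒≤ b = ≮⇒≥ (subst T b ∘ <⇒<ᵇ)

  saturated⇒≥ : ∀ {v} → saturated v ≡ true → K ≤ degree G v
  saturated⇒≥ {v} s = ≤ᵇ⇒≤ K (degree G v) (Equivalence.from T-≡ s)

  unsaturated⇒< : ∀ {v} → saturated v ≡ false → degree G v < K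
  unsaturated⇒< s = ≰⇒> (subst T s ∘ ≤⇒≤ᵇ)

  big-neighbour⇒small : ∀ {u v} → Edge G u v → big u ≡ true → big v ≡ false
  big-neighbour⇒small {u} {v} e bu with big v in bv
  ... | true  = ⊥-elim (sparse u v e (big⇒> bu , big⇒> bv))
  ... | false = refl

  nearBig-witness : ∀ {w} → nearBig w ≡ true → ∃ λ y → Edge G w y × big y ≡ true
  nearBig-witness {w} nb
    with y , adj∧big ← satisfied (any⁻ _ (allFin n) (Equivalence.from T-≡ nb))
    with adjacent , isBig ← Equivalence.to T-∧ adj∧big
    = y , Equivalence.to T-≡ adjacent , Equivalence.to T-≡ isBig

  big-neighbour⇒nearBig : ∀ {w y} → Edge G w y → big y ≡ true → nearBig w ≡ true
  big-neighbour⇒nearBig {y = y} e b =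
    Equivalence.to T-≡ (any⁺ _ (Any.map (λ { refl → adj∧big }) (∈-allFin y)))
    where adj∧big = Equivalence.from T-∧ (Equivalence.from T-≡ e , Equivalence.from T-≡ b)

  nearBig⇒small : ∀ {w} → nearBig w ≡ true → big w ≡ false
  nearBig⇒small nb with y , e , by ← nearBig-witness nb = big-neighbour⇒small (Edge-sym G e) by

  big⇒far : ∀ {v} → big v ≡ true → nearBig v ≡ false
  big⇒far {v} bv with nearBig v in nb
  ... | true  with () ← trans (sym bv) (nearBig⇒small nb)
  ... | false = refl

  far⇒small-neighbour : ∀ {w y} → nearBig w ≡ false → Edge G w y → big y ≡ false
  far⇒small-neighbour {w} {y} nb e with big y in by
  ... | true  with () ← trans (sym nb) (big-neighbour⇒nearBig e by)
  ... | false = refl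

  across₀ : ∀ {u v} → Edge G u v → side u ≡ 0ℙ → side v ≡ 1ℙ
  across₀ e su = trans (≢⇒≡⁻¹ (bipartite e)) (cong _⁻¹ su)

  across₁ : ∀ {u v} → Edge G u v → side u ≡ 1ℙ → side v ≡ 0ℙ
  across₁ e su = trans (≢⇒≡⁻¹ (bipartite e)) (cong _⁻¹ su)

  edge-sides : ∀ {u v} → Edge G u v → side u ≡ 0ℙ ⊎ side v ≡ 0ℙ
  edge-sides {u} e with side u in su
  ... | 0ℙ = inj₁ refl
  ... | 1ℙ = inj₂ (across₁ e su)

  forward : Fin n → Fin n → Bool
  forward a w = big a ∨ (nearBig w ∧ not (saturated a))

  forward-big : ∀ {a w} → big a ≡ true → forward a w ≡ true
  forward-big ba rewrite ba = refl

  forward-far : ∀ {a w} → big a ≡ false → nearBig w ≡ false → forward a w ≡ false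
  forward-far ba nw rewrite ba | nw = refl

  forward-saturated : ∀ {a w} → big a ≡ false → saturated a ≡ true → forward a w ≡ false
  forward-saturated {w = w} ba sa rewrite ba | sa = ∧-zeroʳ (nearBig w)

  forward-unsaturated : ∀ {a w} → big a ≡ false → nearBig w ≡ true → saturated a ≡ false →
                        forward a w ≡ true
  forward-unsaturated ba nw sa rewrite ba | nw | sa = refl

  towards : Parity → Fin n → Fin n → Bool
  towards 0ℙ u v = forward u v
  towards 1ℙ u v = not (forward v u)

  arcs : Fin n → Fin n → Bool
  arcs u v = adj G u v ∧ towards (side u) u v

  arcs⇒Edge : ∀ u v → arcs u v ≡ true → Edge G u v
  arcs⇒Edge u v a with adj G u v
  ... | true = refl

  arcs-forward : ∀ {a w} → Edge G a w → side a ≡ 0ℙ → arcs a w ≡ forward a w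
  arcs-forward e sa rewrite e | sa = refl

  arcs-backward : ∀ {a w} → Edge G a w → side a ≡ 0ℙ → arcs w a ≡ not (forward a w)
  arcs-backward e sa rewrite Edge-sym G e | across₀ e sa = refl

  orientation : Orientation G
  orientation = record { arc = arcs ; arc⇒edge = arcs⇒Edge ; oneDir = one-direction }
    where
    one-direction : ∀ u v → Edge G u v → arcs u v xor arcs v u ≡ true
    one-direction u v e with edge-sides e
    ... | inj₁ su rewrite arcs-forward e su | arcs-backward e su = xor-inverseʳ (forward u v)
    ... | inj₂ sv rewrite arcs-forward (Edge-sym G e) sv | arcs-backward (Edge-sym G e) sv =
      xor-inverseˡ (forward v u)

  d⁻ : Fin n → ℕ
  d⁻ = indegree orientation

  d⁻≤degree : ∀ v → d⁻ v ≤ degree G v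
  d⁻≤degree v = countIn-mono (λ u a → Edge-sym G (arcs⇒Edge u v a)) (allFin n)

  in-arc⇒d⁻>0 : ∀ {u v} → arcs u v ≡ true → 0 < d⁻ v
  in-arc⇒d⁻>0 {u} a = countIn-pos (∈-allFin u) a

  two-in-arcs⇒d⁻≥2 : ∀ {u u′ v} → u ≢ u′ → arcs u v ≡ true → arcs u′ v ≡ true → 2 ≤ d⁻ v
  two-in-arcs⇒d⁻≥2 {u} {u′} u≢u′ = countIn-two u≢u′ (∈-allFin u) (∈-allFin u′)

  out-arc⇒d⁻<degree : ∀ {u v} → Edge G v u → arcs u v ≡ false → d⁻ v < degree G v
  out-arc⇒d⁻<degree {u} {v} e a =
    countIn-strictMono (λ x a′ → Edge-sym G (arcs⇒Edge x v a′)) (∈-allFin u) e a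

  all-in⇒degree≤d⁻ : ∀ {v} → (∀ u → Edge G v u → arcs u v ≡ true) → degree G v ≤ d⁻ v
  all-in⇒degree≤d⁻ all-in = countIn-mono all-in (allFin n)

  no-in⇒d⁻≡0 : ∀ {v} → (∀ u → Edge G u v → arcs u v ≡ false) → d⁻ v ≡ 0
  no-in⇒d⁻≡0 {v} no-in = countIn-zero noArc (allFin n)
    where
    noArc : ∀ u → arcs u v ≡ false
    noArc u with adj G u v in e
    ... | true  = trans (cong (_∧ towards (side u) u v) (sym e)) (no-in u e)
    ... | false = refl

  big⇒d⁻≡0 : ∀ {v} → big v ≡ true → d⁻ v ≡ 0
  big⇒d⁻≡0 {v} bv = no-in⇒d⁻≡0 noArc
    where
    noArc : ∀ u → Edge G u v → arcs u v ≡ false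
    noArc u e with edge-sides e
    ... | inj₁ su =
      trans (arcs-forward e su) (forward-far (big-neighbour⇒small (Edge-sym G e) bv) (big⇒far bv))
    ... | inj₂ sv = trans (arcs-backward (Edge-sym G e) sv) (cong not (forward-big bv))

  far⇒d⁻≡0 : ∀ {w} → side w ≡ 1ℙ → nearBig w ≡ false → d⁻ w ≡ 0
  far⇒d⁻≡0 {w} sw nw = no-in⇒d⁻≡0 noArc
    where
    noArc : ∀ u → Edge G u w → arcs u w ≡ false
    noArc u e = trans (arcs-forward e (across₁ (Edge-sym G e) sw))
                      (forward-far (far⇒small-neighbour nw (Edge-sym G e)) nw)

  saturated⇒K≤d⁻ : ∀ {a} → side a ≡ 0ℙ → big a ≡ false → saturated a ≡ true → K ≤ d⁻ a
  saturated⇒K≤d⁻ sa ba sat = ≤-trans (saturated⇒≥ sat) (all-in⇒degree≤d⁻ allIn)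
    where
    allIn = λ u e → trans (arcs-backward e sa) (cong not (forward-saturated ba sat))

  unsaturated-across : ∀ {a w} → Edge G a w → side a ≡ 0ℙ → big a ≡ false → nearBig w ≡ true →
                       saturated a ≡ false → d⁻ a < d⁻ w
  unsaturated-across {a} e sa ba nw sat with y , w~y , by ← nearBig-witness nw =
    <-≤-trans d⁻a<2 (two-in-arcs⇒d⁻≥2 y≢a y→w a→w)
    where
    a→w = trans (arcs-forward e sa) (forward-unsaturated ba nw sat)
    y→w = trans (arcs-forward (Edge-sym G w~y) (across₁ w~y (across₀ e sa))) (forward-big by)
    y≢a : y ≢ a
    y≢a refl with () ← trans (sym ba) by
    d⁻a<degree = out-arc⇒d⁻<degree e (trans (arcs-backward e sa) (cong not (forward-unsaturated ba nw sat)))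
    d⁻a<2 : d⁻ a < 2
    d⁻a<2 = ≤-pred (begin
      2 + d⁻ a        ≤⟨ s≤s d⁻a<degree ⟩
      1 + degree G a  ≤⟨ unsaturated⇒< sat ⟩
      K               ≤⟨ K≤3 ⟩
      3               ∎)
      where open ≤-Reasoning

  proper-across : ∀ {a w} → Edge G a w → side a ≡ 0ℙ → d⁻ a ≢ d⁻ w
  proper-across {a} {w} e sa with big a in ba | nearBig w in nw | saturated a in sat
  ... | true | _ | _ = <⇒≢ (subst (_< d⁻ w) (sym (big⇒d⁻≡0 ba)) (in-arc⇒d⁻>0 a→w))
    where a→w = trans (arcs-forward e sa) (forward-big ba)
  ... | false | false | _ = >⇒≢ (subst (_< d⁻ a) (sym (far⇒d⁻≡0 (across₀ e sa) nw)) (in-arc⇒d⁻>0 w→a))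
    where w→a = trans (arcs-backward e sa) (cong not (forward-far ba nw))
  ... | false | true | true = >⇒≢ (begin-strict
    d⁻ w        <⟨ out-arc⇒d⁻<degree (Edge-sym G e) a↛w ⟩
    degree G w  ≤⟨ small⇒≤ (nearBig⇒small nw) ⟩
    K           ≤⟨ saturated⇒K≤d⁻ sa ba sat ⟩
    d⁻ a        ∎)
    where
    a↛w = trans (arcs-forward e sa) (forward-saturated ba sat)
    open ≤-Reasoning
  ... | false | true | false = <⇒≢ (unsaturated-across e sa ba nw sat)

  proper : Proper orientation
  proper u v e with edge-sides e
  ... | inj₁ su = proper-across e su
  ... | inj₂ sv = ≢-sym (proper-across (Edge-sym G e) sv)

  bounded : IsKOrientation K orientation
  bounded v with big v in bv
  ... | true  = subst (_≤ K) (sym (big⇒d⁻≡0 bv)) z≤n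
  ... | false = ≤-trans (d⁻≤degree v) (small⇒≤ bv)

sparse-bipartite⇒χ⃗≤ : ∀ {n} (G : Graph n) K → K ≤ 3 → Bipartite G →
                      NoAdjacentBothDeg≥ G (suc K) → OrientedChromatic≤ G K
sparse-bipartite⇒χ⃗≤ G K K≤3 (side , bipartite) sparse = orientation , proper , bounded
  where open SparseBipartite G K K≤3 side bipartite sparse

corollary26 : ∀ {n} (T : Graph n) → IsTree T →
  (NoAdjacentBothDeg≥ T 3 → OrientedChromatic≤ T 2) ×
  (NoAdjacentBothDeg≥ T 4 → OrientedChromatic≤ T 3)
corollary26 T tree =
    sparse-bipartite⇒χ⃗≤ T 2 (n≤1+n 2) bipartite
  , sparse-bipartite⇒χ⃗≤ T 3 ≤-refl bipartite
  where bipartite = tree⇒bipartite T tree
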